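{- The inclusion $I\colon\mathbf{CABA}_{\mathsf c}\hookrightarrow\mathbf{EA}_\sigma$ is dense.
   Context: An effect algebra is a partial commutative monoid $(A,\oplus,0)$ with an operation $(-)^\perp$ such that $x^\perp$ is the unique element with $x\oplus x^\perp=1$, where $1=0^\perp$, and $x\oplus1$ is defined iff $x=0$. A $\sigma$-effect algebra is an effect algebra with a partial countable sum operation $\bigoplus_{n<\omega}\colon A^\omega\rightharpoonup A$ that is commutative (invariant under permutations of the arguments), associative, and compatible with $0$ and $\oplus$; $\mathbf{EA}_\sigma$ is the category of $\sigma$-effect algebras and maps preserving all this structure. $\mathbf{CABA}_{\mathsf c}$ is the full subcategory of $\mathbf{EA}_\sigma$ on the Boolean algebras $2^A$ for countable sets $A$ (countable sums being unions of pairwise disjoint families, $x^\perp$ the complement). A functor $G\colon\mathcal{A}\to\mathcal{B}$ is dense if every $B\in\mathcal{B}$ is the canonical colimit of all morphisms $GA\to B$, equivalently $B\mapsto\mathcal{B}(G-,B)$ is fully faithful. -}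

module Defs where

open import Data.Nat using (ℕ; zero; suc)
open import Data.Bool using (Bool; true; false; not; _∨_)
open import Data.Product using (Σ; ∃; _×_; _,_; proj₁; proj₂; uncurry)
open import Data.Empty using (⊥)
open import Relation.Nullary using (¬_)
open import Relation.Binary.PropositionalEquality using (_≡_)
open import Relation.Binary.Structures using (IsEquivalence)
open import Relation.Binary.Definitions using (Transitive)
open import Function.Bundles using (_↔_; _↣_; _⇔_; Inverse)

-- Partial operations are encoded as (functional) relations:
--   x ⊕ y ≃ z   means  "x ⊕ y is defined and equals z",
--   ⨁ f ≃ s     means  "⨁_{n<ω} f n is defined and equals s".

record σSig : Set₁ where
  infix 4 _≈_
  infixl 8 _ᗮ
  field
    Carrier : Set
    _≈_     : Carrier → Carrier → Set
    0#      : Carrier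
    _ᗮ      : Carrier → Carrier
    _⊕_≃_   : Carrier → Carrier → Carrier → Set
    ⨁_≃_    : (ℕ → Carrier) → Carrier → Set

  1# : Carrier
  1# = 0# ᗮ

  pair : Carrier → Carrier → ℕ → Carrier
  pair x y zero          = x
  pair x y (suc zero)    = y
  pair x y (suc (suc _)) = 0#

record σEA : Set₁ where
  field
    sig : σSig
  open σSig sig public
  field
    isEquivalence : IsEquivalence _≈_
    ⊕-resp     : ∀ {x x′ y y′ z z′} → x ≈ x′ → y ≈ y′ → z ≈ z′ →
                 x ⊕ y ≃ z → x′ ⊕ y′ ≃ z′
    ⊕-func     : ∀ {x y z z′} → x ⊕ y ≃ z → x ⊕ y ≃ z′ → z ≈ z′
    ⊕-comm     : ∀ {x y z} → x ⊕ y ≃ z → y ⊕ x ≃ z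
    ⊕-assoc    : ∀ {x y z u w} → x ⊕ y ≃ u → u ⊕ z ≃ w →
                 ∃ λ v → (y ⊕ z ≃ v) × (x ⊕ v ≃ w)
    ⊕-identity : ∀ x → x ⊕ 0# ≃ x
    ᗮ-resp     : ∀ {x y} → x ≈ y → x ᗮ ≈ y ᗮ
    ᗮ-inverse  : ∀ x → x ⊕ x ᗮ ≃ 1#
    ᗮ-unique   : ∀ {x y} → x ⊕ y ≃ 1# → y ≈ x ᗮ
    zero-one   : ∀ {x z} → x ⊕ 1# ≃ z → x ≈ 0#
    ⨁-resp     : ∀ {f g s t} → (∀ n → f n ≈ g n) → s ≈ t → ⨁ f ≃ s → ⨁ g ≃ t
    ⨁-func     : ∀ {f s t} → ⨁ f ≃ s → ⨁ f ≃ t → s ≈ t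
    ⨁-perm     : ∀ {f s} (π : ℕ ↔ ℕ) → ⨁ f ≃ s → ⨁ (λ n → f (Inverse.to π n)) ≃ s
    ⨁-assoc    : (e : ℕ ↔ (ℕ × ℕ)) (f : ℕ → ℕ → Carrier) (t : Carrier) →
                 (⨁ (λ k → uncurry f (Inverse.to e k)) ≃ t) ⇔
                 (∃ λ (s : ℕ → Carrier) → (∀ n → ⨁ f n ≃ s n) × (⨁ s ≃ t))
    ⨁-zero     : ⨁ (λ _ → 0#) ≃ 0#
    ⨁-⊕        : ∀ x y z → (⨁ pair x y ≃ z) ⇔ (x ⊕ y ≃ z)

record Hom (P Q : σSig) : Set where
  private
    module P = σSig P
    module Q = σSig Q
  field
    fun   : P.Carrier → Q.Carrier
    resp  : ∀ {x y} → x P.≈ y → fun x Q.≈ fun y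
    pres-0 : fun P.0# Q.≈ Q.0#
    pres-1 : fun P.1# Q.≈ Q.1#
    pres-ᗮ : ∀ x → fun (x P.ᗮ) Q.≈ (fun x) Q.ᗮ
    pres-⊕ : ∀ {x y z} → x P.⊕ y ≃ z → fun x Q.⊕ fun y ≃ fun z
    pres-⨁ : ∀ {f s} → P.⨁ f ≃ s → Q.⨁ (λ n → fun (f n)) ≃ fun s

open Hom public

_≈ₕ_ : {P Q : σSig} → Hom P Q → Hom P Q → Set
_≈ₕ_ {P} {Q} g h = ∀ x → σSig._≈_ Q (fun g x) (fun h x)

compose : {P Q R : σSig} → Transitive (σSig._≈_ R) →
          Hom P Q → Hom Q R → Hom P R
compose {P} {Q} {R} tr u g = record
  { fun    = λ x → fun g (fun u x)
  ; resp   = λ p → resp g (resp u p)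
  ; pres-0 = tr (resp g (pres-0 u)) (pres-0 g)
  ; pres-1 = tr (resp g (pres-1 u)) (pres-1 g)
  ; pres-ᗮ = λ x → tr (resp g (pres-ᗮ u x)) (pres-ᗮ g (fun u x))
  ; pres-⊕ = λ p → pres-⊕ g (pres-⊕ u p)
  ; pres-⨁ = λ p → pres-⨁ g (pres-⨁ u p)
  }

-- The objects of CABA_c: Boolean algebras 2^A, A countable.

record Countable : Set₁ where
  field
    Elt : Set
    enc : Elt ↣ ℕ

open Countable public

Pow : Countable → σSig
Pow A = record
  { Carrier = Elt A → Bool
  ; _≈_     = λ x y → ∀ a → x a ≡ y a
  ; 0#      = λ _ → false
  ; _ᗮ      = λ x a → not (x a)
  ; _⊕_≃_   = λ x y z → (∀ a → x a ≡ true → y a ≡ true → ⊥) ×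
                        (∀ a → z a ≡ (x a ∨ y a))
  ; ⨁_≃_    = λ f s → (∀ m n a → ¬ (m ≡ n) → f m a ≡ true → f n a ≡ true → ⊥) ×
                       (∀ a → (s a ≡ true) ⇔ (∃ λ n → f n a ≡ true))
  }

-- Density of I : CABA_c ↪ EA_σ :  the functor
--   B ↦ EA_σ(I -, B) : EA_σ → [CABA_cᵒᵖ, Set]
-- is fully faithful.

private
  ≈-trans : (B : σEA) → Transitive (σEA._≈_ B)
  ≈-trans B = IsEquivalence.trans (σEA.isEquivalence B)

precomp : (B : σEA) (A A′ : Countable) →
          Hom (Pow A′) (Pow A) → Hom (Pow A) (σEA.sig B) → Hom (Pow A′) (σEA.sig B)
precomp B A A′ u g = compose (≈-trans B) u g

postcomp : (B C : σEA) (A : Countable) →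
           Hom (Pow A) (σEA.sig B) → Hom (σEA.sig B) (σEA.sig C) → Hom (Pow A) (σEA.sig C)
postcomp B C A g h = compose (≈-trans C) g h

record NatTrans (B C : σEA) : Set₁ where
  field
    α       : (A : Countable) → Hom (Pow A) (σEA.sig B) → Hom (Pow A) (σEA.sig C)
    α-resp  : (A : Countable) (g g′ : Hom (Pow A) (σEA.sig B)) →
              g ≈ₕ g′ → α A g ≈ₕ α A g′
    natural : (A A′ : Countable) (u : Hom (Pow A′) (Pow A))
              (g : Hom (Pow A) (σEA.sig B)) →
              α A′ (precomp B A A′ u g) ≈ₕ precomp C A A′ u (α A g)

open NatTrans public

Dense : Set₁
Dense = (B C : σEA) →
  ((η : NatTrans B C) →
     ∃ λ (h : Hom (σEA.sig B) (σEA.sig C)) →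
       (A : Countable) (g : Hom (Pow A) (σEA.sig B)) →
         α η A g ≈ₕ postcomp B C A g h)
  ×
  ((h h′ : Hom (σEA.sig B) (σEA.sig C)) →
     ((A : Countable) (g : Hom (Pow A) (σEA.sig B)) →
        postcomp B C A g h ≈ₕ postcomp B C A g h′) →
     h ≈ₕ h′)

{-# OPTIONS --safe #-}

-- Every x in B is the value at {0} of the σ-morphism 2^ℕ → B, T ↦ ⨁_{n∈T} (x, xᗮ, 0, 0, …),
-- so a morphism out of B is determined by its composites with maps 2^ℕ → B: faithfulness.
-- For fullness, given η put h x := η(that morphism)({0}). For g : 2^A → B and S ⊆ A,
-- precomposing g with the preimage map of the classifier A → {0,1} ⊆ ℕ of S gives the
-- morphism of g S (σ-morphisms out of 2^ℕ are determined on singletons), so naturality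
-- yields η(g)(S) = h(g S). And h preserves ⨁: if ⨁ f = s, then (sᗮ, f₀, f₁, …) is a
-- partition of unity whose morphism 2^ℕ → B sends {n+1} to fₙ and the complement of {0}
-- to s, and η of it preserves the sum ⨁ₙ {n+1} = complement of {0}. Preservation of ⊕
-- and ᗮ follows from that of ⨁. Sub-sums and re-indexings of countable sums all come
-- from the associativity axiom (transposing double sums), plus the permutation axiom to
-- move a single nonzero term.

module Submission where

open import Defs
open import Data.Bool using (Bool; true; false; not; _∨_; if_then_else_)
open import Data.Bool.Properties using (∨-inverseʳ; ∨-zeroʳ)
open import Data.Empty using (⊥; ⊥-elim)
open import Data.Nat using (ℕ; zero; suc; _+_)
open import Data.Nat.Properties
  using (_≟_; +-comm; +-suc; +-identityʳ; suc-injective; m+n≡0⇒n≡0; 0≢1+n)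
open import Data.Product using (∃; _×_; _,_; proj₁; proj₂)
open import Data.Product.Algebra using (×-comm)
open import Function.Base using (flip)
open import Function.Bundles using (_↔_; _⇔_; mk↔ₛ′; Equivalence; mk⇔)
open import Function.Construct.Composition using (_↔-∘_)
open import Function.Construct.Identity using (↣-id)
open import Relation.Binary.Bundles using (Setoid)
import Relation.Binary.Reasoning.Setoid as SetoidReasoning
open import Relation.Binary.PropositionalEquality using (_≡_; _≢_; refl; sym; trans; cong; subst)
open import Relation.Binary.Structures using (IsEquivalence)
open import Relation.Nullary using (yes; no; does; contradiction)
open import Relation.Nullary.Decidable using (dec-true; dec-false)

module CantorPairing where
  private
    next : ℕ × ℕ → ℕ × ℕ
    next (i , zero)  = (0 , suc i)
    next (i , suc j) = (suc i , j)

    unpair : ℕ → ℕ × ℕ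
    unpair zero    = (0 , 0)
    unpair (suc n) = next (unpair n)

    triangle : ℕ → ℕ
    triangle zero    = 0
    triangle (suc k) = suc k + triangle k

    pair : ℕ × ℕ → ℕ
    pair (i , j) = triangle (i + j) + i

    pair-next : ∀ p → pair (next p) ≡ suc (pair p)
    pair-next (i , zero)  rewrite +-identityʳ i | +-identityʳ (i + triangle i) =
      cong suc (+-comm i (triangle i))
    pair-next (i , suc j) rewrite +-suc i j = +-suc (triangle (suc (i + j))) i

    pair-unpair : ∀ n → pair (unpair n) ≡ n
    pair-unpair zero    = refl
    pair-unpair (suc n) = trans (pair-next (unpair n)) (cong suc (pair-unpair n))

    unpair-pair : ∀ n p → pair p ≡ n → unpair n ≡ p
    unpair-pair zero (i , j) eq with m+n≡0⇒n≡0 (triangle (i + j)) eq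
    unpair-pair zero (.0 , zero)  eq | refl = refl
    unpair-pair zero (.0 , suc j) () | refl
    unpair-pair (suc n) (zero , zero) ()
    unpair-pair (suc n) (zero , suc j) eq =
      cong next (unpair-pair n (j , 0) (suc-injective (trans (sym (pair-next (j , 0))) eq)))
    unpair-pair (suc n) (suc i , j) eq =
      cong next (unpair-pair n (i , suc j) (suc-injective (trans (sym (pair-next (i , suc j))) eq)))

  ℕ↔ℕ×ℕ : ℕ ↔ (ℕ × ℕ)
  ℕ↔ℕ×ℕ = mk↔ₛ′ unpair pair (λ p → unpair-pair (pair p) p refl) pair-unpair

open CantorPairing

transpose₀ : ℕ → ℕ → ℕ
transpose₀ zero    k       = k
transpose₀ (suc m) zero    = suc m
transpose₀ (suc m) (suc k) with k ≟ m
... | yes _ = 0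
... | no _  = suc k

transpose₀-zero : ∀ m → transpose₀ m 0 ≡ m
transpose₀-zero zero    = refl
transpose₀-zero (suc m) = refl

transpose₀-involutive : ∀ m k → transpose₀ m (transpose₀ m k) ≡ k
transpose₀-involutive zero    k    = refl
transpose₀-involutive (suc m) zero with m ≟ m
... | yes _   = refl
... | no m≢m  = contradiction refl m≢m
transpose₀-involutive (suc m) (suc k) with k ≟ m in eq
... | yes refl = refl
... | no _     rewrite eq = refl

transpose₀-self : ∀ m → transpose₀ m m ≡ 0
transpose₀-self m = trans (cong (transpose₀ m) (sym (transpose₀-zero m))) (transpose₀-involutive m 0)

transpose₀↔ : ℕ → ℕ ↔ ℕ
transpose₀↔ m =
  mk↔ₛ′ (transpose₀ m) (transpose₀ m) (transpose₀-involutive m) (transpose₀-involutive m)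

cons : {X : Set} → X → (ℕ → X) → ℕ → X
cons x f zero    = x
cons x f (suc n) = f n

module PowerSet (A : Countable) where
  open σSig (Pow A)

  ⊕⇒⨁ : ∀ {S T U} → S ⊕ T ≃ U → ⨁ pair S T ≃ U
  ⊕⇒⨁ {S} {T} {U} (disjoint , union) = pair-disjoint , pair-union
    where
    pair-disjoint : ∀ m n a → m ≢ n → pair S T m a ≡ true → pair S T n a ≡ true → ⊥
    pair-disjoint zero          zero          a m≢n _ _ = m≢n refl
    pair-disjoint zero          (suc zero)    a _   p q = disjoint a p q
    pair-disjoint (suc zero)    zero          a _   p q = disjoint a q p
    pair-disjoint (suc zero)    (suc zero)    a m≢n _ _ = m≢n refl
    pair-disjoint zero          (suc (suc _)) a _   _ ()
    pair-disjoint (suc zero)    (suc (suc _)) a _   _ ()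
    pair-disjoint (suc (suc _)) n             a _   () _

    pair-union : ∀ a → (U a ≡ true) ⇔ (∃ λ n → pair S T n a ≡ true)
    pair-union a = mk⇔ to from
      where
      to : U a ≡ true → ∃ λ n → pair S T n a ≡ true
      to Ua with S a in S-a
      ... | true  = 0 , S-a
      ... | false = 1 , subst (λ b → (b ∨ T a) ≡ true) S-a (trans (sym (union a)) Ua)

      from : (∃ λ n → pair S T n a ≡ true) → U a ≡ true
      from (zero , Sa)       = trans (union a) (cong (_∨ T a) Sa)
      from (suc zero , Ta)   = trans (union a) (trans (cong (S a ∨_) Ta) (∨-zeroʳ (S a)))
      from (suc (suc _) , ())

  ᗮ-inverse : ∀ S → S ⊕ S ᗮ ≃ 1#
  ᗮ-inverse S = (λ a → complement-disjoint (S a)) , (λ a → sym (∨-inverseʳ (S a)))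
    where
    complement-disjoint : ∀ b → b ≡ true → not b ≡ true → ⊥
    complement-disjoint true  _ ()

preimage : {A A′ : Countable} → (Elt A → Elt A′) → Hom (Pow A′) (Pow A)
preimage φ = record
  { fun    = λ T a → T (φ a)
  ; resp   = λ T≈T′ a → T≈T′ (φ a)
  ; pres-0 = λ _ → refl
  ; pres-1 = λ _ → refl
  ; pres-ᗮ = λ _ _ → refl
  ; pres-⊕ = λ (disjoint , union) → (λ a → disjoint (φ a)) , (λ a → union (φ a))
  ; pres-⨁ = λ (disjoint , union) → (λ m n a → disjoint m n (φ a)) , (λ a → union (φ a))
  }

ℕ-countable : Countable
ℕ-countable = record { Elt = ℕ ; enc = ↣-id ℕ }

𝒫ℕ : σSig
𝒫ℕ = Pow ℕ-countable

module 𝒫ℕ = σSig 𝒫ℕ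

｛_｝ : ℕ → 𝒫ℕ.Carrier
｛ m ｝ n = does (n ≟ m)

｛｝-self : ∀ m → ｛ m ｝ m ≡ true
｛｝-self m = dec-true (m ≟ m) refl

｛｝-true : ∀ {m} n → ｛ m ｝ n ≡ true → n ≡ m
｛｝-true {m} n eq with n ≟ m
... | yes n≡m = n≡m
... | no n≢m  = contradiction (trans (sym eq) (dec-false (n ≟ m) n≢m)) λ ()

atom : 𝒫ℕ.Carrier → ℕ → 𝒫ℕ.Carrier
atom T n = if T n then ｛ n ｝ else 𝒫ℕ.0#

atom-true : ∀ T n k → atom T n k ≡ true → k ≡ n × T k ≡ true
atom-true T n k eq with T n in Tn
... | true with ｛｝-true k eq
...   | refl = refl , Tn

atom-self : ∀ T k → T k ≡ true → atom T k k ≡ true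
atom-self T k Tk rewrite Tk = ｛｝-self k

⨁-atoms : ∀ T → 𝒫ℕ.⨁ atom T ≃ T
⨁-atoms T = disjoint , union
  where
  disjoint : ∀ m n k → m ≢ n → atom T m k ≡ true → atom T n k ≡ true → ⊥
  disjoint m n k m≢n p q = m≢n (trans (sym (proj₁ (atom-true T m k p))) (proj₁ (atom-true T n k q)))

  union : ∀ k → (T k ≡ true) ⇔ (∃ λ n → atom T n k ≡ true)
  union k = mk⇔ (λ Tk → k , atom-self T k Tk) (λ (n , eq) → proj₂ (atom-true T n k eq))

⨁-successor-singletons : 𝒫ℕ.⨁ (λ n → ｛ suc n ｝) ≃ (｛ 0 ｝ 𝒫ℕ.ᗮ)
⨁-successor-singletons = disjoint , union
  where
  disjoint : ∀ m n k → m ≢ n → ｛ suc m ｝ k ≡ true → ｛ suc n ｝ k ≡ true → ⊥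
  disjoint m n k m≢n p q = m≢n (suc-injective (trans (sym (｛｝-true k p)) (｛｝-true k q)))

  union : ∀ k → (not (｛ 0 ｝ k) ≡ true) ⇔ (∃ λ n → ｛ suc n ｝ k ≡ true)
  union zero    = mk⇔ (λ ()) (λ { (_ , ()) })
  union (suc k) = mk⇔ (λ _ → k , ｛｝-self (suc k)) (λ _ → refl)

classifier : (A : Countable) → (Elt A → Bool) → Hom 𝒫ℕ (Pow A)
classifier A S = preimage {A} {ℕ-countable} (λ a → if S a then 0 else 1)

classifier-singleton : ∀ A (S : Elt A → Bool) n →
  σSig._≈_ (Pow A) (fun (classifier A S) ｛ n ｝) (σSig.pair (Pow A) S (σSig._ᗮ (Pow A) S) n)
classifier-singleton A S zero          a with S a
... | true  = refl
... | false = refl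
classifier-singleton A S (suc zero)    a with S a
... | true  = refl
... | false = refl
classifier-singleton A S (suc (suc n)) a with S a
... | true  = refl
... | false = refl

module Properties (B : σEA) where
  open σEA B
  open IsEquivalence isEquivalence
    renaming (refl to ≈-refl; sym to ≈-sym; trans to ≈-trans; reflexive to ≈-reflexive)

  ⊕⇒⨁ : ∀ {x y z} → x ⊕ y ≃ z → ⨁ pair x y ≃ z
  ⊕⇒⨁ {x} {y} {z} = Equivalence.from (⨁-⊕ x y z)

  ⨁⇒⊕ : ∀ {x y z} → ⨁ pair x y ≃ z → x ⊕ y ≃ z
  ⨁⇒⊕ {x} {y} {z} = Equivalence.to (⨁-⊕ x y z)

  ⨁-cong : ∀ {f g s t} → ⨁ f ≃ s → ⨁ g ≃ t → (∀ n → f n ≈ g n) → s ≈ t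
  ⨁-cong f-sum g-sum f≈g = ⨁-func (⨁-resp f≈g ≈-refl f-sum) g-sum

  ⨁-zeros : ∀ {f} → (∀ n → f n ≈ 0#) → ⨁ f ≃ 0#
  ⨁-zeros f≈0 = ⨁-resp (λ n → ≈-sym (f≈0 n)) ≈-refl ⨁-zero

  ᗮ-involutive : ∀ x → x ≈ x ᗮ ᗮ
  ᗮ-involutive x = ᗮ-unique (⊕-comm (ᗮ-inverse x))

  pair-0-suc : ∀ x n → pair x 0# (suc n) ≈ 0#
  pair-0-suc x zero    = ≈-refl
  pair-0-suc x (suc n) = ≈-refl

  -- Up to ≈, f is the sequence f m, 0, 0, … permuted by the transposition of 0 and m.
  ⨁-single : ∀ f m → (∀ n → n ≢ m → f n ≈ 0#) → ⨁ f ≃ f m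
  ⨁-single f m f≈0 = ⨁-resp moved ≈-refl (⨁-perm (transpose₀↔ m) (⊕⇒⨁ (⊕-identity (f m))))
    where
    moved : ∀ n → pair (f m) 0# (transpose₀ m n) ≈ f n
    moved n with transpose₀ m n in eq
    ... | zero  = ≈-reflexive (cong f (sym n≡m))
      where
      n≡m : n ≡ m
      n≡m = trans (sym (transpose₀-involutive m n))
                  (trans (cong (transpose₀ m) eq) (transpose₀-zero m))
    ... | suc j = ≈-trans (pair-0-suc (f m) j) (≈-sym (f≈0 n n≢m))
      where
      n≢m : n ≢ m
      n≢m refl = 0≢1+n (trans (sym (transpose₀-self n)) eq)

  restrict : (ℕ → Carrier) → (ℕ → Bool) → ℕ → Carrier
  restrict f P n = if P n then f n else 0#

  ⨁-restrict-single : ∀ f P m → P m ≡ true → (∀ n → n ≢ m → P n ≡ false) →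
                      ⨁ restrict f P ≃ f m
  ⨁-restrict-single f P m Pm P≢m =
    ⨁-resp (λ _ → ≈-refl) (≈-reflexive (cong (if_then f m else 0#) Pm))
      (⨁-single (restrict f P) m λ n n≢m → ≈-reflexive (cong (if_then f n else 0#) (P≢m n n≢m)))

  -- Flattening F along ℕ↔ℕ×ℕ and flattening its transpose along the swapped bijection
  -- give the same sequence, so ⨁-assoc can be used once in each direction.
  ⨁-transpose : ∀ (F : ℕ → ℕ → Carrier) {r s} → (∀ n → ⨁ F n ≃ r n) → ⨁ r ≃ s →
                ∃ λ c → (∀ m → ⨁ (λ n → F n m) ≃ c m) × (⨁ c ≃ s)
  ⨁-transpose F {r} {s} rows total =
    Equivalence.to (⨁-assoc (×-comm ℕ ℕ ↔-∘ ℕ↔ℕ×ℕ) (flip F) s)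
      (Equivalence.from (⨁-assoc ℕ↔ℕ×ℕ F s) (r , rows , total))

  ⨁-restrict : ∀ {f s} → ⨁ f ≃ s → ∀ P → ∃ λ t → ⨁ restrict f P ≃ t
  ⨁-restrict {f} f-sum P =
    let c , columns , _ = ⨁-transpose split rows f-sum in c 0 , columns 0
    where
    split : ℕ → ℕ → Carrier
    split n = pair (restrict f P n) (restrict f (λ k → not (P k)) n)

    rows : ∀ n → ⨁ split n ≃ f n
    rows n with P n
    ... | true  = ⊕⇒⨁ (⊕-identity (f n))
    ... | false = ⊕⇒⨁ (⊕-comm (⊕-identity (f n)))

  ⨁-shift : ∀ {f s} → ⨁ f ≃ s → ⨁ cons 0# f ≃ s
  ⨁-shift {f} f-sum =
    let c , columns , total = ⨁-transpose F rows f-sum in ⨁-resp (column-sums c columns) ≈-refl total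
    where
    F : ℕ → ℕ → Carrier
    F n = restrict (λ _ → f n) ｛ suc n ｝

    rows : ∀ n → ⨁ F n ≃ f n
    rows n = ⨁-restrict-single _ ｛ suc n ｝ (suc n) (｛｝-self (suc n)) λ k → dec-false (k ≟ suc n)

    column-sums : ∀ c → (∀ m → ⨁ (λ n → F n m) ≃ c m) → ∀ m → c m ≈ cons 0# f m
    column-sums c columns zero    = ⨁-func (columns zero) (⨁-zeros (λ _ → ≈-refl))
    column-sums c columns (suc m) = ⨁-func (columns (suc m))
      (⨁-restrict-single f (λ n → does (suc m ≟ suc n)) m (dec-true (suc m ≟ suc m) refl)
        (λ n n≢m → dec-false (suc m ≟ suc n) (λ eq → n≢m (sym (suc-injective eq)))))

  ⨁-cons : ∀ {f s x t} → ⨁ f ≃ s → x ⊕ s ≃ t → ⨁ cons x f ≃ t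
  ⨁-cons {f} {s} {x} f-sum x⊕s =
    let c , columns , total = ⨁-transpose F rows (⊕⇒⨁ (⊕-comm x⊕s))
    in ⨁-resp (λ m → ⨁-func (columns m) (column-sums m)) ≈-refl total
    where
    F : ℕ → ℕ → Carrier
    F zero                = cons 0# f
    F (suc zero) zero     = x
    F (suc zero) (suc _)  = 0#
    F (suc (suc _)) _     = 0#

    rows : ∀ n → ⨁ F n ≃ pair s x n
    rows zero          = ⨁-shift f-sum
    rows (suc zero)    = ⨁-single (F 1) 0 λ
      { zero 0≢0 → contradiction refl 0≢0 ; (suc _) _ → ≈-refl }
    rows (suc (suc _)) = ⨁-zeros (λ _ → ≈-refl)

    column-sums : ∀ m → ⨁ (λ n → F n m) ≃ cons x f m
    column-sums zero    = ⨁-single (λ n → F n 0) 1 λ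
      { zero _ → ≈-refl ; (suc zero) 1≢1 → contradiction refl 1≢1 ; (suc (suc _)) _ → ≈-refl }
    column-sums (suc m) = ⨁-single (λ n → F n (suc m)) 0 λ
      { zero 0≢0 → contradiction refl 0≢0 ; (suc zero) _ → ≈-refl ; (suc (suc _)) _ → ≈-refl }

  ⨁-indicator : ∀ {A : Countable} {T U} → σSig.⨁_≃_ (Pow A) T U → ∀ a x →
                ⨁ (λ k → if T k a then x else 0#) ≃ (if U a then x else 0#)
  ⨁-indicator {T = T} {U} (disjoint , union) a x with U a in Ua
  ... | true  = let k , Tk = Equivalence.to (union a) Ua in
                ⨁-restrict-single (λ _ → x) (λ n → T n a) k Tk (others k Tk)
    where
    others : ∀ k → T k a ≡ true → ∀ n → n ≢ k → T n a ≡ false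
    others k Tk n n≢k with T n a in Tn
    ... | true  = ⊥-elim (disjoint n k a n≢k Tn Tk)
    ... | false = refl
  ... | false = ⨁-zeros none
    where
    none : ∀ k → (if T k a then x else 0#) ≈ 0#
    none k with T k a in Tk
    ... | true  = contradiction (trans (sym (Equivalence.from (union a) (k , Tk))) Ua) λ ()
    ... | false = ≈-refl

  module CountablyAdditive {P : σSig} where
    private
      module P = σSig P

    module _
      (P-⊕⇒⨁ : ∀ {x y z} → x P.⊕ y ≃ z → P.⨁ P.pair x y ≃ z)
      (P-ᗮ-inverse : ∀ x → x P.⊕ x P.ᗮ ≃ P.1#)
      (φ : P.Carrier → Carrier)
      (φ-resp : ∀ {x y} → x P.≈ y → φ x ≈ φ y)
      (φ-0 : φ P.0# ≈ 0#)
      (φ-1 : φ P.1# ≈ 1#)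
      (φ-⨁ : ∀ {f s} → P.⨁ f ≃ s → ⨁ (λ n → φ (f n)) ≃ φ s)
      where

      φ-⊕ : ∀ {x y z} → x P.⊕ y ≃ z → φ x ⊕ φ y ≃ φ z
      φ-⊕ {x} {y} x⊕y = ⨁⇒⊕ (⨁-resp φ-pair ≈-refl (φ-⨁ (P-⊕⇒⨁ x⊕y)))
        where
        φ-pair : ∀ n → φ (P.pair x y n) ≈ pair (φ x) (φ y) n
        φ-pair zero          = ≈-refl
        φ-pair (suc zero)    = ≈-refl
        φ-pair (suc (suc _)) = φ-0

      φ-ᗮ : ∀ x → φ (x P.ᗮ) ≈ φ x ᗮ
      φ-ᗮ x = ᗮ-unique (⊕-resp ≈-refl ≈-refl φ-1 (φ-⊕ (P-ᗮ-inverse x)))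

      hom : Hom P sig
      hom = record
        { fun = φ ; resp = φ-resp ; pres-0 = φ-0 ; pres-1 = φ-1
        ; pres-ᗮ = φ-ᗮ ; pres-⊕ = φ-⊕ ; pres-⨁ = φ-⨁ }

  module Partition (f : ℕ → Carrier) (f-sum : ⨁ f ≃ 1#) where
    measure : 𝒫ℕ.Carrier → Carrier
    measure T = proj₁ (⨁-restrict f-sum T)

    ⨁-measure : ∀ T → ⨁ restrict f T ≃ measure T
    ⨁-measure T = proj₂ (⨁-restrict f-sum T)

    measure-⨁ : ∀ {T U} → 𝒫ℕ.⨁ T ≃ U → ⨁ (λ k → measure (T k)) ≃ measure U
    measure-⨁ {T} {U} T-sum =
      let c , columns , total = ⨁-transpose (λ n k → restrict f (T k) n)
                                  (λ n → ⨁-indicator {A = ℕ-countable} T-sum n (f n)) (⨁-measure U)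
      in ⨁-resp (λ k → ⨁-func (columns k) (⨁-measure (T k))) ≈-refl total

    measure-singleton : ∀ m → measure ｛ m ｝ ≈ f m
    measure-singleton m = ⨁-func (⨁-measure ｛ m ｝)
      (⨁-restrict-single f ｛ m ｝ m (｛｝-self m) (λ n → dec-false (n ≟ m)))

    hom : Hom 𝒫ℕ sig
    hom = CountablyAdditive.hom (PowerSet.⊕⇒⨁ ℕ-countable) (PowerSet.ᗮ-inverse ℕ-countable)
      measure
      (λ T≈T′ → ⨁-cong (⨁-measure _) (⨁-measure _) λ n →
                  ≈-reflexive (cong (if_then f n else 0#) (T≈T′ n)))
      (⨁-func (⨁-measure 𝒫ℕ.0#) (⨁-zeros (λ _ → ≈-refl)))
      (⨁-func (⨁-measure 𝒫ℕ.1#) f-sum)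
      measure-⨁

  elementHom : Carrier → Hom 𝒫ℕ sig
  elementHom x = Partition.hom (pair x (x ᗮ)) (⊕⇒⨁ (ᗮ-inverse x))

  elementHom-singleton : ∀ x n → fun (elementHom x) ｛ n ｝ ≈ pair x (x ᗮ) n
  elementHom-singleton x = Partition.measure-singleton (pair x (x ᗮ)) (⊕⇒⨁ (ᗮ-inverse x))

  hom-ext : (G G′ : Hom 𝒫ℕ sig) → (∀ n → fun G ｛ n ｝ ≈ fun G′ ｛ n ｝) → G ≈ₕ G′
  hom-ext G G′ agree T = ⨁-cong (pres-⨁ G (⨁-atoms T)) (pres-⨁ G′ (⨁-atoms T)) on-atoms
    where
    on-atoms : ∀ n → fun G (atom T n) ≈ fun G′ (atom T n)
    on-atoms n with T n
    ... | true  = agree n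
    ... | false = ≈-trans (pres-0 G) (≈-sym (pres-0 G′))

  elementHom-resp : ∀ {x y} → x ≈ y → elementHom x ≈ₕ elementHom y
  elementHom-resp {x} {y} x≈y = hom-ext (elementHom x) (elementHom y) λ n →
    ≈-trans (elementHom-singleton x n) (≈-trans (pair-resp n) (≈-sym (elementHom-singleton y n)))
    where
    pair-resp : ∀ n → pair x (x ᗮ) n ≈ pair y (y ᗮ) n
    pair-resp zero          = x≈y
    pair-resp (suc zero)    = ᗮ-resp x≈y
    pair-resp (suc (suc _)) = ≈-refl

  classifier-factorisation : (A : Countable) (g : Hom (Pow A) sig) (S : Elt A → Bool) →
                             compose ≈-trans (classifier A S) g ≈ₕ elementHom (fun g S)
  classifier-factorisation A g S =
    hom-ext (compose ≈-trans (classifier A S) g) (elementHom (fun g S)) λ n →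
      ≈-trans (resp g (classifier-singleton A S n))
        (≈-trans (g-pair n) (≈-sym (elementHom-singleton (fun g S) n)))
    where
    g-pair : ∀ n → fun g (σSig.pair (Pow A) S (σSig._ᗮ (Pow A) S) n) ≈
                   pair (fun g S) (fun g S ᗮ) n
    g-pair zero          = ≈-refl
    g-pair (suc zero)    = pres-ᗮ g S
    g-pair (suc (suc _)) = pres-0 g

module Fullness (B C : σEA) (η : NatTrans B C) where
  private
    module B where
      open σEA B public
      open IsEquivalence isEquivalence public using (sym; trans)
    module C = σEA C
    module PB = Properties B
    module PC = Properties C
    C-setoid : Setoid _ _
    C-setoid = record { isEquivalence = C.isEquivalence }
  open Setoid C-setoid using () renaming (sym to ≈-sym; trans to ≈-trans)
  open SetoidReasoning C-setoid

  h : B.Carrier → C.Carrier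
  h x = fun (α η ℕ-countable (PB.elementHom x)) ｛ 0 ｝

  α≈h∘ : (A : Countable) (g : Hom (Pow A) B.sig) (S : Elt A → Bool) →
         fun (α η A g) S C.≈ h (fun g S)
  α≈h∘ A g S = begin
    fun (α η A g) S
      ≈⟨ resp (α η A g) (λ a → sym (classifier-singleton A S 0 a)) ⟩
    fun (α η A g) (fun (classifier A S) ｛ 0 ｝)
      ≈⟨ natural η A ℕ-countable (classifier A S) g ｛ 0 ｝ ⟨
    fun (α η ℕ-countable (precomp B A ℕ-countable (classifier A S) g)) ｛ 0 ｝
      ≈⟨ α-resp η ℕ-countable _ _ (PB.classifier-factorisation A g S) ｛ 0 ｝ ⟩
    h (fun g S) ∎

  h-resp : ∀ {x y} → x B.≈ y → h x C.≈ h y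
  h-resp x≈y = α-resp η ℕ-countable _ _ (PB.elementHom-resp x≈y) ｛ 0 ｝

  h-transport : ∀ (G : Hom 𝒫ℕ B.sig) T {x} → fun G T B.≈ x → h x C.≈ fun (α η ℕ-countable G) T
  h-transport G T GT≈x = ≈-trans (h-resp (B.sym GT≈x)) (≈-sym (α≈h∘ ℕ-countable G T))

  h-0 : h B.0# C.≈ C.0#
  h-0 = ≈-trans (h-transport G 𝒫ℕ.0# (pres-0 G)) (pres-0 (α η ℕ-countable G))
    where G = PB.elementHom B.0#

  h-1 : h B.1# C.≈ C.1#
  h-1 = ≈-trans (h-transport G 𝒫ℕ.1# (pres-1 G)) (pres-1 (α η ℕ-countable G))
    where G = PB.elementHom B.0#

  h-⨁ : ∀ {f s} → B.⨁ f ≃ s → C.⨁ (λ n → h (f n)) ≃ h s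
  h-⨁ {f} {s} f-sum = C.⨁-resp
    (λ n → ≈-sym (h-transport G ｛ suc n ｝ (measure-singleton (suc n))))
    (≈-sym (h-transport G (｛ 0 ｝ 𝒫ℕ.ᗮ) G-complement))
    (pres-⨁ (α η ℕ-countable G) ⨁-successor-singletons)
    where
    partition : B.⨁ cons (s B.ᗮ) f ≃ B.1#
    partition = PB.⨁-cons f-sum (B.⊕-comm (B.ᗮ-inverse s))

    open PB.Partition (cons (s B.ᗮ) f) partition using (measure-singleton) renaming (hom to G)

    G-complement : fun G (｛ 0 ｝ 𝒫ℕ.ᗮ) B.≈ s
    G-complement = B.trans (pres-ᗮ G ｛ 0 ｝)
                     (B.trans (B.ᗮ-resp (measure-singleton 0)) (B.sym (PB.ᗮ-involutive s)))

  hom : Hom B.sig C.sig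
  hom = PC.CountablyAdditive.hom PB.⊕⇒⨁ B.ᗮ-inverse h h-resp h-0 h-1 h-⨁

faithful : (B C : σEA) (h h′ : Hom (σEA.sig B) (σEA.sig C)) →
           ((A : Countable) (g : Hom (Pow A) (σEA.sig B)) →
              postcomp B C A g h ≈ₕ postcomp B C A g h′) →
           h ≈ₕ h′
faithful B C h h′ agree x =
  C.trans (resp h (B.sym (G｛0｝≈x)))
    (C.trans (agree ℕ-countable (Properties.elementHom B x) ｛ 0 ｝) (resp h′ G｛0｝≈x))
  where
  module B = IsEquivalence (σEA.isEquivalence B)
  module C = IsEquivalence (σEA.isEquivalence C)
  G｛0｝≈x : σEA._≈_ B (fun (Properties.elementHom B x) ｛ 0 ｝) x
  G｛0｝≈x = Properties.elementHom-singleton B x 0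

lemma6p7 : Dense
lemma6p7 B C = (λ η → Fullness.hom B C η , Fullness.α≈h∘ B C η) , faithful B C
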